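{- For every positive integer $n \leq 20$ we have $f(K_n) \leq n$.
   Context: Let $G$ be a graph. A set $P \subseteq E(G)$ separates two edges $e,e' \in E(G)$ if $P$ contains exactly one of $e,e'$. A separating path system for $G$ is a family $\mathcal{S}$ of paths in $G$ (each viewed as its set of edges) such that for every pair of distinct edges $e,e' \in E(G)$ some $P \in \mathcal{S}$ separates $e$ and $e'$. $f(G)$ denotes the minimum size of a separating path system for $G$, and $K_n$ is the complete graph on $n$ vertices. -}

module Defs where

open import Data.Nat using (ℕ; _≤_)
open import Data.Fin using (Fin; _<_)
open import Data.List using (List; []; _∷_; length)
open import Data.List.Relation.Unary.Any using (Any)
open import Data.List.Relation.Unary.All using (All)
open import Data.List.Relation.Unary.Unique.Propositional using (Unique)
open import Data.Product using (Σ; _×_; _,_; proj₁)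
open import Data.Sum using (_⊎_)
open import Relation.Binary.PropositionalEquality using (_≡_; _≢_)
open import Relation.Nullary using (¬_)

-- The complete graph K_n: vertex set Fin n, every pair of distinct vertices adjacent.
-- An edge {u , v} of K_n is represented canonically as an ordered pair (u , v) with u < v.
Edge : ℕ → Set
Edge n = Σ (Fin n × Fin n) λ uv → proj₁ uv < Data.Product.proj₂ uv

DistinctEdges : {n : ℕ} → Edge n → Edge n → Set
DistinctEdges e e' = proj₁ e ≢ proj₁ e'

-- A path in K_n: a sequence of pairwise distinct vertices (any two consecutive
-- vertices are distinct, hence adjacent in K_n).
Path : ℕ → Set
Path n = Σ (List (Fin n)) Unique

data Consecutive {n : ℕ} (u v : Fin n) : List (Fin n) → Set where
  here  : ∀ {a b xs} → (a ≡ u × b ≡ v) ⊎ (a ≡ v × b ≡ u) →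
          Consecutive u v (a ∷ b ∷ xs)
  there : ∀ {a xs} → Consecutive u v xs → Consecutive u v (a ∷ xs)

_∈ₑ_ : {n : ℕ} → Edge n → Path n → Set
((u , v) , _) ∈ₑ P = Consecutive u v (proj₁ P)

Separates : {n : ℕ} → Path n → Edge n → Edge n → Set
Separates P e e' = (e ∈ₑ P × ¬ (e' ∈ₑ P)) ⊎ (e' ∈ₑ P × ¬ (e ∈ₑ P))

SeparatingPathSystem : (n : ℕ) → List (Path n) → Set
SeparatingPathSystem n S =
  (e e' : Edge n) → DistinctEdges e e' → Any (λ P → Separates P e e') S

-- f(K_n) ≤ k : there is a separating path system for K_n of size at most k.
fKLe : ℕ → ℕ → Set
fKLe n k = Σ (List (Path n)) λ S → SeparatingPathSystem n S × length S ≤ k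

module Submission where

-- A family S of paths separates the edges of K_n exactly when the edges have pairwise distinct
-- codes, the code of an edge being its membership vector (e ∈ P)_{P ∈ S}.  For each n ≤ 20 we
-- exhibit at most n Hamiltonian paths of K_n and certify that their codes are distinct by
-- tabulating code ↦ edge and checking that the table decodes every edge.

open import Defs
open import Agda.Builtin.FromNat using (Number; fromNat)
open import Data.Bool using (Bool; true; false)
import Data.Bool.Properties as Bool
open import Data.Fin using (Fin; _<_; toℕ; fromℕ<)
import Data.Fin.Literals as Fin
open import Data.Fin.Properties using (_≟_; _<?_; all?; toℕ-fromℕ<)
open import Data.List using (List; []; _∷_; map; filter; cartesianProduct; allFin; length)
import Data.List.Relation.Binary.Lex.Strict as Lex
open import Data.List.Relation.Unary.Any using (Any; here; there)
open import Data.List.Relation.Unary.Unique.DecPropositional using (unique?)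
open import Data.Maybe using (Maybe; just)
import Data.Maybe.Properties as Maybe
open import Data.Nat using (ℕ; _≤_; _≤?_; s≤s)
import Data.Nat.Literals as ℕ
open import Data.Product using (_×_; _,_; proj₁)
import Data.Product.Properties as Product
open import Data.Sum using (inj₁; inj₂; [_,_]′)
open import Data.Tree.AVL.Map (Lex.<-strictTotalOrder Bool.<-strictTotalOrder) using (fromList; lookup)
open import Data.Unit using (⊤; tt)
open import Function using (_∘_)
open import Relation.Binary.PropositionalEquality using (_≡_; _≢_; refl; cong; sym; subst; module ≡-Reasoning)
open import Relation.Nullary using (Dec; yes; no; does; contradiction)
open import Relation.Nullary.Decidable using (map′; _×-dec_; _⊎-dec_; _→-dec_; True; toWitness; from-yes)

private
  variable
    n k : ℕ

consecutive? : (u v : Fin n) (xs : List (Fin n)) → Dec (Consecutive u v xs)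
consecutive? u v [] = no λ ()
consecutive? u v (a ∷ []) = no λ { (there ()) }
consecutive? u v (a ∷ b ∷ xs) =
  map′ [ here , there ]′ (λ { (here p) → inj₁ p ; (there q) → inj₂ q })
       (((a ≟ u ×-dec b ≟ v) ⊎-dec (a ≟ v ×-dec b ≟ u)) ⊎-dec consecutive? u v (b ∷ xs))

_∈ₑ?_ : (e : Edge n) (P : Path n) → Dec (e ∈ₑ P)
((u , v) , _) ∈ₑ? P = consecutive? u v (proj₁ P)

code : List (Path n) → Fin n → Fin n → List Bool
code S u v = map (λ P → does (consecutive? u v (proj₁ P))) S

separates-if-codes-differ : (S : List (Path n)) (e@((u , v) , _) e'@((u' , v') , _) : Edge n) →
  code S u v ≢ code S u' v' → Any (λ P → Separates P e e') S
separates-if-codes-differ [] e e' codes≢ = contradiction refl codes≢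
separates-if-codes-differ (P ∷ S) e e' codes≢ with e ∈ₑ? P | e' ∈ₑ? P
... | yes e∈P | no  e'∉P = here (inj₁ (e∈P , e'∉P))
... | no  e∉P | yes e'∈P = here (inj₂ (e'∈P , e∉P))
... | yes _   | yes _    = there (separates-if-codes-differ S e e' (codes≢ ∘ cong (true ∷_)))
... | no  _   | no  _    = there (separates-if-codes-differ S e e' (codes≢ ∘ cong (false ∷_)))

Decodes : List (Path n) → (List Bool → Maybe (Fin n × Fin n)) → Set
Decodes {n} S decode = (u v : Fin n) → u < v → decode (code S u v) ≡ just (u , v)

decodable⇒separating : (S : List (Path n)) (decode : List Bool → Maybe (Fin n × Fin n)) →
  Decodes S decode → SeparatingPathSystem n S
decodable⇒separating S decode decodes e@((u , v) , u<v) e'@((u' , v') , u'<v') e≢e' =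
  separates-if-codes-differ S e e' (e≢e' ∘ code-injective)
  where
  code-injective : code S u v ≡ code S u' v' → (u , v) ≡ (u' , v')
  code-injective codes≡ = Maybe.just-injective (begin
    just (u , v)          ≡⟨ sym (decodes u v u<v) ⟩
    decode (code S u v)   ≡⟨ cong decode codes≡ ⟩
    decode (code S u' v') ≡⟨ decodes u' v' u'<v' ⟩
    just (u' , v')        ∎)
    where open ≡-Reasoning

decodable⇒fKLe : (S : List (Path n)) (decode : List Bool → Maybe (Fin n × Fin n)) →
  Decodes S decode → length S ≤ k → fKLe n k
decodable⇒fKLe S decode decodes |S|≤k = S , decodable⇒separating S decode decodes , |S|≤k

edges : (n : ℕ) → List (Fin n × Fin n)
edges n = filter (λ (u , v) → u <? v) (cartesianProduct (allFin n) (allFin n))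

-- If two edges share a code, the later entry of the table overwrites the earlier one, which then
-- fails to decode.
decoder : List (Path n) → List Bool → Maybe (Fin n × Fin n)
decoder {n} S = lookup (fromList (map (λ (u , v) → code S u v , (u , v)) (edges n)))

decodes? : (S : List (Path n)) (decode : List Bool → Maybe (Fin n × Fin n)) → Dec (Decodes S decode)
decodes? S decode = all? λ u → all? λ v →
  u <? v →-dec Maybe.≡-dec (Product.≡-dec _≟_ _≟_) (decode (code S u v)) (just (u , v))

path : (xs : List (Fin n)) → {True (unique? _≟_ xs)} → Path n
path xs {distinct} = xs , toWitness distinct

private
  instance
    ⊤-instance : ⊤
    ⊤-instance = tt

    ℕ-number : Number ℕ
    ℕ-number = ℕ.number

    Fin-number : Number (Fin n)
    Fin-number {n} = Fin.number n

pathSystem : (n : ℕ) → List (Path n)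
pathSystem 3 =
     path (2 ∷ 1 ∷ 0 ∷ [])
  ∷ path (1 ∷ 2 ∷ 0 ∷ [])
  ∷ []
pathSystem 4 =
     path (3 ∷ 1 ∷ 0 ∷ 2 ∷ [])
  ∷ path (2 ∷ 1 ∷ 3 ∷ 0 ∷ [])
  ∷ path (2 ∷ 3 ∷ 0 ∷ 1 ∷ [])
  ∷ path (2 ∷ 0 ∷ 3 ∷ 1 ∷ [])
  ∷ []
pathSystem 5 =
     path (3 ∷ 4 ∷ 0 ∷ 1 ∷ 2 ∷ [])
  ∷ path (3 ∷ 2 ∷ 1 ∷ 4 ∷ 0 ∷ [])
  ∷ path (4 ∷ 1 ∷ 3 ∷ 0 ∷ 2 ∷ [])
  ∷ path (4 ∷ 2 ∷ 3 ∷ 0 ∷ 1 ∷ [])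
  ∷ path (2 ∷ 4 ∷ 0 ∷ 1 ∷ 3 ∷ [])
  ∷ []
pathSystem 6 =
     path (3 ∷ 5 ∷ 0 ∷ 1 ∷ 2 ∷ 4 ∷ [])
  ∷ path (4 ∷ 0 ∷ 3 ∷ 5 ∷ 2 ∷ 1 ∷ [])
  ∷ path (2 ∷ 1 ∷ 0 ∷ 5 ∷ 4 ∷ 3 ∷ [])
  ∷ path (1 ∷ 5 ∷ 2 ∷ 0 ∷ 4 ∷ 3 ∷ [])
  ∷ path (4 ∷ 2 ∷ 0 ∷ 5 ∷ 3 ∷ 1 ∷ [])
  ∷ path (4 ∷ 3 ∷ 2 ∷ 5 ∷ 1 ∷ 0 ∷ [])
  ∷ []
pathSystem 7 =
     path (5 ∷ 3 ∷ 6 ∷ 0 ∷ 1 ∷ 2 ∷ 4 ∷ [])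
  ∷ path (6 ∷ 1 ∷ 0 ∷ 2 ∷ 3 ∷ 5 ∷ 4 ∷ [])
  ∷ path (0 ∷ 6 ∷ 3 ∷ 4 ∷ 1 ∷ 2 ∷ 5 ∷ [])
  ∷ path (0 ∷ 5 ∷ 6 ∷ 2 ∷ 1 ∷ 4 ∷ 3 ∷ [])
  ∷ path (1 ∷ 2 ∷ 3 ∷ 4 ∷ 0 ∷ 6 ∷ 5 ∷ [])
  ∷ path (6 ∷ 4 ∷ 2 ∷ 0 ∷ 5 ∷ 3 ∷ 1 ∷ [])
  ∷ path (5 ∷ 3 ∷ 0 ∷ 1 ∷ 6 ∷ 4 ∷ 2 ∷ [])
  ∷ []
pathSystem 8 =
     path (5 ∷ 1 ∷ 3 ∷ 6 ∷ 2 ∷ 0 ∷ 7 ∷ 4 ∷ [])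
  ∷ path (3 ∷ 1 ∷ 5 ∷ 4 ∷ 7 ∷ 6 ∷ 0 ∷ 2 ∷ [])
  ∷ path (0 ∷ 3 ∷ 4 ∷ 1 ∷ 6 ∷ 7 ∷ 2 ∷ 5 ∷ [])
  ∷ path (3 ∷ 7 ∷ 4 ∷ 6 ∷ 5 ∷ 2 ∷ 1 ∷ 0 ∷ [])
  ∷ path (1 ∷ 5 ∷ 3 ∷ 0 ∷ 6 ∷ 4 ∷ 7 ∷ 2 ∷ [])
  ∷ path (7 ∷ 5 ∷ 6 ∷ 2 ∷ 3 ∷ 0 ∷ 1 ∷ 4 ∷ [])
  ∷ path (5 ∷ 0 ∷ 1 ∷ 7 ∷ 4 ∷ 6 ∷ 3 ∷ 2 ∷ [])
  ∷ path (5 ∷ 3 ∷ 7 ∷ 1 ∷ 6 ∷ 0 ∷ 2 ∷ 4 ∷ [])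
  ∷ []
pathSystem 9 =
     path (8 ∷ 6 ∷ 2 ∷ 1 ∷ 4 ∷ 3 ∷ 0 ∷ 7 ∷ 5 ∷ [])
  ∷ path (8 ∷ 7 ∷ 2 ∷ 3 ∷ 5 ∷ 4 ∷ 0 ∷ 6 ∷ 1 ∷ [])
  ∷ path (3 ∷ 6 ∷ 8 ∷ 4 ∷ 7 ∷ 5 ∷ 1 ∷ 0 ∷ 2 ∷ [])
  ∷ path (4 ∷ 3 ∷ 6 ∷ 1 ∷ 7 ∷ 8 ∷ 2 ∷ 0 ∷ 5 ∷ [])
  ∷ path (8 ∷ 3 ∷ 6 ∷ 1 ∷ 7 ∷ 0 ∷ 4 ∷ 5 ∷ 2 ∷ [])
  ∷ path (3 ∷ 5 ∷ 6 ∷ 1 ∷ 8 ∷ 0 ∷ 2 ∷ 4 ∷ 7 ∷ [])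
  ∷ path (7 ∷ 5 ∷ 2 ∷ 0 ∷ 3 ∷ 1 ∷ 8 ∷ 4 ∷ 6 ∷ [])
  ∷ path (2 ∷ 8 ∷ 5 ∷ 6 ∷ 0 ∷ 4 ∷ 1 ∷ 3 ∷ 7 ∷ [])
  ∷ path (0 ∷ 8 ∷ 1 ∷ 5 ∷ 6 ∷ 2 ∷ 7 ∷ 3 ∷ 4 ∷ [])
  ∷ []
pathSystem 10 =
     path (0 ∷ 6 ∷ 2 ∷ 7 ∷ 5 ∷ 8 ∷ 4 ∷ 1 ∷ 9 ∷ 3 ∷ [])
  ∷ path (8 ∷ 0 ∷ 9 ∷ 1 ∷ 7 ∷ 3 ∷ 4 ∷ 6 ∷ 5 ∷ 2 ∷ [])
  ∷ path (9 ∷ 2 ∷ 8 ∷ 4 ∷ 5 ∷ 0 ∷ 1 ∷ 6 ∷ 7 ∷ 3 ∷ [])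
  ∷ path (8 ∷ 1 ∷ 4 ∷ 9 ∷ 2 ∷ 0 ∷ 3 ∷ 6 ∷ 5 ∷ 7 ∷ [])
  ∷ path (4 ∷ 3 ∷ 5 ∷ 1 ∷ 6 ∷ 8 ∷ 2 ∷ 7 ∷ 0 ∷ 9 ∷ [])
  ∷ path (2 ∷ 5 ∷ 8 ∷ 7 ∷ 1 ∷ 3 ∷ 6 ∷ 9 ∷ 0 ∷ 4 ∷ [])
  ∷ path (5 ∷ 0 ∷ 2 ∷ 9 ∷ 6 ∷ 8 ∷ 3 ∷ 7 ∷ 4 ∷ 1 ∷ [])
  ∷ path (8 ∷ 0 ∷ 7 ∷ 9 ∷ 5 ∷ 4 ∷ 1 ∷ 3 ∷ 6 ∷ 2 ∷ [])
  ∷ path (9 ∷ 5 ∷ 1 ∷ 7 ∷ 8 ∷ 6 ∷ 4 ∷ 2 ∷ 3 ∷ 0 ∷ [])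
  ∷ path (0 ∷ 5 ∷ 4 ∷ 7 ∷ 6 ∷ 1 ∷ 8 ∷ 9 ∷ 3 ∷ 2 ∷ [])
  ∷ []
pathSystem 11 =
     path (3 ∷ 8 ∷ 4 ∷ 0 ∷ 1 ∷ 10 ∷ 9 ∷ 2 ∷ 5 ∷ 6 ∷ 7 ∷ [])
  ∷ path (5 ∷ 1 ∷ 9 ∷ 6 ∷ 2 ∷ 3 ∷ 4 ∷ 10 ∷ 7 ∷ 0 ∷ 8 ∷ [])
  ∷ path (7 ∷ 2 ∷ 0 ∷ 8 ∷ 10 ∷ 3 ∷ 1 ∷ 4 ∷ 6 ∷ 9 ∷ 5 ∷ [])
  ∷ path (0 ∷ 6 ∷ 8 ∷ 9 ∷ 7 ∷ 4 ∷ 10 ∷ 3 ∷ 5 ∷ 2 ∷ 1 ∷ [])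
  ∷ path (2 ∷ 10 ∷ 9 ∷ 1 ∷ 7 ∷ 4 ∷ 8 ∷ 5 ∷ 0 ∷ 6 ∷ 3 ∷ [])
  ∷ path (0 ∷ 3 ∷ 9 ∷ 5 ∷ 8 ∷ 2 ∷ 4 ∷ 6 ∷ 1 ∷ 10 ∷ 7 ∷ [])
  ∷ path (1 ∷ 6 ∷ 2 ∷ 7 ∷ 0 ∷ 10 ∷ 8 ∷ 3 ∷ 5 ∷ 9 ∷ 4 ∷ [])
  ∷ path (4 ∷ 8 ∷ 1 ∷ 3 ∷ 7 ∷ 9 ∷ 2 ∷ 6 ∷ 0 ∷ 5 ∷ 10 ∷ [])
  ∷ path (1 ∷ 8 ∷ 9 ∷ 6 ∷ 3 ∷ 0 ∷ 4 ∷ 5 ∷ 2 ∷ 10 ∷ 7 ∷ [])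
  ∷ path (8 ∷ 2 ∷ 10 ∷ 6 ∷ 5 ∷ 1 ∷ 4 ∷ 3 ∷ 7 ∷ 9 ∷ 0 ∷ [])
  ∷ path (5 ∷ 1 ∷ 0 ∷ 4 ∷ 9 ∷ 3 ∷ 10 ∷ 6 ∷ 8 ∷ 7 ∷ 2 ∷ [])
  ∷ []
pathSystem 12 =
     path (6 ∷ 5 ∷ 4 ∷ 9 ∷ 10 ∷ 8 ∷ 3 ∷ 0 ∷ 11 ∷ 2 ∷ 7 ∷ 1 ∷ [])
  ∷ path (4 ∷ 8 ∷ 6 ∷ 3 ∷ 2 ∷ 1 ∷ 7 ∷ 9 ∷ 11 ∷ 10 ∷ 0 ∷ 5 ∷ [])
  ∷ path (4 ∷ 8 ∷ 3 ∷ 1 ∷ 6 ∷ 9 ∷ 0 ∷ 7 ∷ 5 ∷ 2 ∷ 10 ∷ 11 ∷ [])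
  ∷ path (1 ∷ 8 ∷ 2 ∷ 3 ∷ 10 ∷ 4 ∷ 6 ∷ 7 ∷ 9 ∷ 5 ∷ 11 ∷ 0 ∷ [])
  ∷ path (4 ∷ 11 ∷ 2 ∷ 6 ∷ 1 ∷ 3 ∷ 9 ∷ 7 ∷ 8 ∷ 0 ∷ 10 ∷ 5 ∷ [])
  ∷ path (4 ∷ 0 ∷ 2 ∷ 10 ∷ 5 ∷ 6 ∷ 8 ∷ 11 ∷ 7 ∷ 3 ∷ 1 ∷ 9 ∷ [])
  ∷ path (0 ∷ 8 ∷ 10 ∷ 6 ∷ 9 ∷ 5 ∷ 1 ∷ 11 ∷ 3 ∷ 4 ∷ 2 ∷ 7 ∷ [])
  ∷ path (10 ∷ 8 ∷ 2 ∷ 5 ∷ 1 ∷ 0 ∷ 7 ∷ 11 ∷ 6 ∷ 4 ∷ 9 ∷ 3 ∷ [])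
  ∷ path (7 ∷ 6 ∷ 10 ∷ 1 ∷ 4 ∷ 2 ∷ 5 ∷ 8 ∷ 11 ∷ 9 ∷ 3 ∷ 0 ∷ [])
  ∷ path (1 ∷ 8 ∷ 6 ∷ 2 ∷ 9 ∷ 3 ∷ 11 ∷ 5 ∷ 0 ∷ 4 ∷ 7 ∷ 10 ∷ [])
  ∷ path (11 ∷ 6 ∷ 4 ∷ 8 ∷ 0 ∷ 9 ∷ 2 ∷ 7 ∷ 3 ∷ 5 ∷ 1 ∷ 10 ∷ [])
  ∷ path (9 ∷ 10 ∷ 3 ∷ 6 ∷ 0 ∷ 2 ∷ 4 ∷ 7 ∷ 8 ∷ 5 ∷ 11 ∷ 1 ∷ [])
  ∷ []
pathSystem 13 =
     path (12 ∷ 5 ∷ 2 ∷ 4 ∷ 1 ∷ 8 ∷ 0 ∷ 11 ∷ 3 ∷ 7 ∷ 10 ∷ 9 ∷ 6 ∷ [])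
  ∷ path (10 ∷ 0 ∷ 1 ∷ 6 ∷ 8 ∷ 9 ∷ 4 ∷ 11 ∷ 7 ∷ 5 ∷ 2 ∷ 12 ∷ 3 ∷ [])
  ∷ path (9 ∷ 2 ∷ 11 ∷ 0 ∷ 7 ∷ 12 ∷ 4 ∷ 10 ∷ 3 ∷ 1 ∷ 5 ∷ 6 ∷ 8 ∷ [])
  ∷ path (0 ∷ 7 ∷ 6 ∷ 11 ∷ 8 ∷ 10 ∷ 4 ∷ 9 ∷ 3 ∷ 2 ∷ 1 ∷ 12 ∷ 5 ∷ [])
  ∷ path (2 ∷ 4 ∷ 12 ∷ 0 ∷ 3 ∷ 1 ∷ 11 ∷ 9 ∷ 8 ∷ 5 ∷ 7 ∷ 6 ∷ 10 ∷ [])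
  ∷ path (1 ∷ 9 ∷ 7 ∷ 8 ∷ 4 ∷ 6 ∷ 12 ∷ 3 ∷ 2 ∷ 5 ∷ 11 ∷ 10 ∷ 0 ∷ [])
  ∷ path (12 ∷ 8 ∷ 2 ∷ 6 ∷ 0 ∷ 7 ∷ 3 ∷ 9 ∷ 4 ∷ 11 ∷ 10 ∷ 5 ∷ 1 ∷ [])
  ∷ path (11 ∷ 12 ∷ 6 ∷ 2 ∷ 1 ∷ 0 ∷ 4 ∷ 7 ∷ 9 ∷ 10 ∷ 3 ∷ 8 ∷ 5 ∷ [])
  ∷ path (11 ∷ 2 ∷ 0 ∷ 12 ∷ 6 ∷ 9 ∷ 5 ∷ 3 ∷ 4 ∷ 7 ∷ 1 ∷ 8 ∷ 10 ∷ [])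
  ∷ path (9 ∷ 12 ∷ 2 ∷ 7 ∷ 1 ∷ 0 ∷ 11 ∷ 8 ∷ 4 ∷ 5 ∷ 3 ∷ 6 ∷ 10 ∷ [])
  ∷ path (6 ∷ 0 ∷ 3 ∷ 12 ∷ 10 ∷ 9 ∷ 2 ∷ 7 ∷ 11 ∷ 5 ∷ 8 ∷ 1 ∷ 4 ∷ [])
  ∷ path (5 ∷ 6 ∷ 11 ∷ 3 ∷ 4 ∷ 0 ∷ 2 ∷ 10 ∷ 1 ∷ 7 ∷ 8 ∷ 12 ∷ 9 ∷ [])
  ∷ path (11 ∷ 9 ∷ 0 ∷ 2 ∷ 8 ∷ 3 ∷ 6 ∷ 4 ∷ 12 ∷ 1 ∷ 10 ∷ 7 ∷ 5 ∷ [])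
  ∷ []
pathSystem 14 =
     path (4 ∷ 10 ∷ 8 ∷ 6 ∷ 9 ∷ 13 ∷ 3 ∷ 11 ∷ 0 ∷ 5 ∷ 7 ∷ 12 ∷ 1 ∷ 2 ∷ [])
  ∷ path (8 ∷ 11 ∷ 2 ∷ 13 ∷ 1 ∷ 4 ∷ 9 ∷ 10 ∷ 0 ∷ 7 ∷ 12 ∷ 6 ∷ 3 ∷ 5 ∷ [])
  ∷ path (11 ∷ 9 ∷ 7 ∷ 13 ∷ 0 ∷ 5 ∷ 10 ∷ 12 ∷ 3 ∷ 6 ∷ 1 ∷ 2 ∷ 4 ∷ 8 ∷ [])
  ∷ path (5 ∷ 13 ∷ 8 ∷ 12 ∷ 4 ∷ 7 ∷ 9 ∷ 1 ∷ 11 ∷ 10 ∷ 2 ∷ 3 ∷ 0 ∷ 6 ∷ [])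
  ∷ path (2 ∷ 8 ∷ 3 ∷ 4 ∷ 11 ∷ 0 ∷ 9 ∷ 12 ∷ 6 ∷ 7 ∷ 5 ∷ 1 ∷ 10 ∷ 13 ∷ [])
  ∷ path (4 ∷ 13 ∷ 10 ∷ 8 ∷ 1 ∷ 6 ∷ 7 ∷ 11 ∷ 5 ∷ 9 ∷ 3 ∷ 0 ∷ 12 ∷ 2 ∷ [])
  ∷ path (13 ∷ 9 ∷ 4 ∷ 3 ∷ 10 ∷ 7 ∷ 0 ∷ 5 ∷ 12 ∷ 11 ∷ 1 ∷ 8 ∷ 2 ∷ 6 ∷ [])
  ∷ path (8 ∷ 0 ∷ 12 ∷ 13 ∷ 5 ∷ 1 ∷ 11 ∷ 3 ∷ 4 ∷ 7 ∷ 6 ∷ 10 ∷ 9 ∷ 2 ∷ [])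
  ∷ path (7 ∷ 2 ∷ 5 ∷ 10 ∷ 12 ∷ 4 ∷ 6 ∷ 3 ∷ 9 ∷ 0 ∷ 8 ∷ 11 ∷ 13 ∷ 1 ∷ [])
  ∷ path (10 ∷ 1 ∷ 4 ∷ 0 ∷ 11 ∷ 7 ∷ 2 ∷ 6 ∷ 13 ∷ 3 ∷ 12 ∷ 8 ∷ 5 ∷ 9 ∷ [])
  ∷ path (3 ∷ 1 ∷ 0 ∷ 4 ∷ 7 ∷ 13 ∷ 10 ∷ 11 ∷ 6 ∷ 8 ∷ 9 ∷ 12 ∷ 5 ∷ 2 ∷ [])
  ∷ path (1 ∷ 7 ∷ 8 ∷ 9 ∷ 5 ∷ 3 ∷ 2 ∷ 12 ∷ 11 ∷ 13 ∷ 0 ∷ 6 ∷ 10 ∷ 4 ∷ [])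
  ∷ path (9 ∷ 8 ∷ 3 ∷ 7 ∷ 1 ∷ 12 ∷ 13 ∷ 6 ∷ 11 ∷ 5 ∷ 4 ∷ 2 ∷ 10 ∷ 0 ∷ [])
  ∷ path (0 ∷ 6 ∷ 5 ∷ 12 ∷ 10 ∷ 7 ∷ 3 ∷ 1 ∷ 4 ∷ 9 ∷ 11 ∷ 8 ∷ 13 ∷ 2 ∷ [])
  ∷ []
pathSystem 15 =
     path (7 ∷ 12 ∷ 3 ∷ 13 ∷ 10 ∷ 1 ∷ 8 ∷ 2 ∷ 0 ∷ 6 ∷ 9 ∷ 5 ∷ 11 ∷ 14 ∷ 4 ∷ [])
  ∷ path (3 ∷ 13 ∷ 8 ∷ 9 ∷ 14 ∷ 10 ∷ 0 ∷ 12 ∷ 1 ∷ 6 ∷ 4 ∷ 5 ∷ 11 ∷ 2 ∷ 7 ∷ [])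
  ∷ path (0 ∷ 5 ∷ 12 ∷ 8 ∷ 7 ∷ 2 ∷ 9 ∷ 3 ∷ 1 ∷ 13 ∷ 14 ∷ 4 ∷ 11 ∷ 6 ∷ 10 ∷ [])
  ∷ path (8 ∷ 6 ∷ 14 ∷ 3 ∷ 5 ∷ 7 ∷ 11 ∷ 10 ∷ 1 ∷ 0 ∷ 2 ∷ 9 ∷ 12 ∷ 4 ∷ 13 ∷ [])
  ∷ path (6 ∷ 2 ∷ 13 ∷ 5 ∷ 7 ∷ 1 ∷ 12 ∷ 3 ∷ 10 ∷ 11 ∷ 8 ∷ 0 ∷ 14 ∷ 9 ∷ 4 ∷ [])
  ∷ path (0 ∷ 3 ∷ 14 ∷ 5 ∷ 12 ∷ 1 ∷ 7 ∷ 6 ∷ 13 ∷ 9 ∷ 10 ∷ 8 ∷ 11 ∷ 2 ∷ 4 ∷ [])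
  ∷ path (13 ∷ 6 ∷ 0 ∷ 12 ∷ 10 ∷ 4 ∷ 3 ∷ 9 ∷ 1 ∷ 5 ∷ 2 ∷ 14 ∷ 8 ∷ 7 ∷ 11 ∷ [])
  ∷ path (8 ∷ 14 ∷ 6 ∷ 4 ∷ 0 ∷ 11 ∷ 3 ∷ 5 ∷ 9 ∷ 7 ∷ 10 ∷ 12 ∷ 13 ∷ 1 ∷ 2 ∷ [])
  ∷ path (4 ∷ 10 ∷ 5 ∷ 8 ∷ 3 ∷ 13 ∷ 11 ∷ 14 ∷ 0 ∷ 9 ∷ 12 ∷ 2 ∷ 1 ∷ 7 ∷ 6 ∷ [])
  ∷ path (11 ∷ 9 ∷ 6 ∷ 3 ∷ 7 ∷ 0 ∷ 2 ∷ 4 ∷ 1 ∷ 8 ∷ 13 ∷ 5 ∷ 10 ∷ 12 ∷ 14 ∷ [])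
  ∷ path (0 ∷ 5 ∷ 14 ∷ 12 ∷ 6 ∷ 8 ∷ 3 ∷ 2 ∷ 13 ∷ 7 ∷ 10 ∷ 4 ∷ 9 ∷ 1 ∷ 11 ∷ [])
  ∷ path (9 ∷ 7 ∷ 14 ∷ 10 ∷ 0 ∷ 8 ∷ 1 ∷ 4 ∷ 13 ∷ 6 ∷ 11 ∷ 12 ∷ 2 ∷ 3 ∷ 5 ∷ [])
  ∷ path (11 ∷ 9 ∷ 10 ∷ 14 ∷ 1 ∷ 3 ∷ 4 ∷ 0 ∷ 13 ∷ 7 ∷ 12 ∷ 8 ∷ 5 ∷ 6 ∷ 2 ∷ [])
  ∷ path (6 ∷ 5 ∷ 4 ∷ 7 ∷ 0 ∷ 1 ∷ 12 ∷ 8 ∷ 2 ∷ 14 ∷ 13 ∷ 9 ∷ 3 ∷ 11 ∷ 10 ∷ [])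
  ∷ path (7 ∷ 3 ∷ 0 ∷ 9 ∷ 8 ∷ 4 ∷ 14 ∷ 1 ∷ 11 ∷ 12 ∷ 13 ∷ 2 ∷ 5 ∷ 6 ∷ 10 ∷ [])
  ∷ []
pathSystem 16 =
     path (7 ∷ 14 ∷ 3 ∷ 8 ∷ 9 ∷ 6 ∷ 4 ∷ 12 ∷ 0 ∷ 10 ∷ 1 ∷ 13 ∷ 2 ∷ 11 ∷ 5 ∷ 15 ∷ [])
  ∷ path (14 ∷ 1 ∷ 11 ∷ 3 ∷ 10 ∷ 8 ∷ 4 ∷ 0 ∷ 7 ∷ 12 ∷ 13 ∷ 5 ∷ 2 ∷ 15 ∷ 6 ∷ 9 ∷ [])
  ∷ path (5 ∷ 0 ∷ 11 ∷ 14 ∷ 15 ∷ 1 ∷ 9 ∷ 13 ∷ 8 ∷ 7 ∷ 4 ∷ 10 ∷ 6 ∷ 2 ∷ 3 ∷ 12 ∷ [])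
  ∷ path (7 ∷ 14 ∷ 13 ∷ 11 ∷ 4 ∷ 9 ∷ 6 ∷ 8 ∷ 3 ∷ 5 ∷ 1 ∷ 15 ∷ 0 ∷ 2 ∷ 12 ∷ 10 ∷ [])
  ∷ path (4 ∷ 7 ∷ 9 ∷ 10 ∷ 15 ∷ 13 ∷ 12 ∷ 1 ∷ 0 ∷ 8 ∷ 11 ∷ 5 ∷ 3 ∷ 6 ∷ 14 ∷ 2 ∷ [])
  ∷ path (4 ∷ 6 ∷ 1 ∷ 11 ∷ 14 ∷ 13 ∷ 10 ∷ 15 ∷ 9 ∷ 3 ∷ 7 ∷ 2 ∷ 8 ∷ 12 ∷ 5 ∷ 0 ∷ [])
  ∷ path (13 ∷ 0 ∷ 12 ∷ 6 ∷ 8 ∷ 1 ∷ 10 ∷ 7 ∷ 2 ∷ 15 ∷ 14 ∷ 9 ∷ 11 ∷ 3 ∷ 4 ∷ 5 ∷ [])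
  ∷ path (15 ∷ 13 ∷ 6 ∷ 1 ∷ 2 ∷ 14 ∷ 0 ∷ 3 ∷ 4 ∷ 11 ∷ 10 ∷ 9 ∷ 5 ∷ 8 ∷ 7 ∷ 12 ∷ [])
  ∷ path (13 ∷ 5 ∷ 12 ∷ 15 ∷ 3 ∷ 0 ∷ 6 ∷ 7 ∷ 1 ∷ 2 ∷ 11 ∷ 9 ∷ 4 ∷ 14 ∷ 10 ∷ 8 ∷ [])
  ∷ path (4 ∷ 8 ∷ 12 ∷ 1 ∷ 9 ∷ 14 ∷ 0 ∷ 15 ∷ 3 ∷ 13 ∷ 2 ∷ 10 ∷ 6 ∷ 11 ∷ 7 ∷ 5 ∷ [])
  ∷ path (3 ∷ 1 ∷ 14 ∷ 6 ∷ 10 ∷ 12 ∷ 11 ∷ 15 ∷ 2 ∷ 4 ∷ 5 ∷ 9 ∷ 8 ∷ 13 ∷ 7 ∷ 0 ∷ [])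
  ∷ path (8 ∷ 0 ∷ 9 ∷ 2 ∷ 14 ∷ 3 ∷ 10 ∷ 4 ∷ 13 ∷ 5 ∷ 1 ∷ 7 ∷ 15 ∷ 12 ∷ 11 ∷ 6 ∷ [])
  ∷ path (1 ∷ 13 ∷ 10 ∷ 7 ∷ 15 ∷ 4 ∷ 2 ∷ 5 ∷ 6 ∷ 3 ∷ 9 ∷ 12 ∷ 14 ∷ 11 ∷ 0 ∷ 8 ∷ [])
  ∷ path (6 ∷ 15 ∷ 5 ∷ 10 ∷ 2 ∷ 7 ∷ 0 ∷ 12 ∷ 9 ∷ 13 ∷ 4 ∷ 14 ∷ 3 ∷ 1 ∷ 8 ∷ 11 ∷ [])
  ∷ path (10 ∷ 14 ∷ 5 ∷ 6 ∷ 13 ∷ 11 ∷ 7 ∷ 1 ∷ 0 ∷ 9 ∷ 15 ∷ 8 ∷ 3 ∷ 2 ∷ 12 ∷ 4 ∷ [])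
  ∷ path (0 ∷ 6 ∷ 12 ∷ 3 ∷ 9 ∷ 10 ∷ 11 ∷ 13 ∷ 7 ∷ 5 ∷ 14 ∷ 8 ∷ 2 ∷ 1 ∷ 15 ∷ 4 ∷ [])
  ∷ []
pathSystem 17 =
     path (12 ∷ 10 ∷ 9 ∷ 6 ∷ 14 ∷ 5 ∷ 2 ∷ 3 ∷ 4 ∷ 0 ∷ 1 ∷ 16 ∷ 8 ∷ 13 ∷ 7 ∷ 11 ∷ 15 ∷ [])
  ∷ path (4 ∷ 15 ∷ 9 ∷ 7 ∷ 14 ∷ 12 ∷ 8 ∷ 1 ∷ 5 ∷ 6 ∷ 0 ∷ 2 ∷ 3 ∷ 11 ∷ 16 ∷ 10 ∷ 13 ∷ [])
  ∷ path (13 ∷ 10 ∷ 14 ∷ 9 ∷ 16 ∷ 7 ∷ 1 ∷ 11 ∷ 12 ∷ 4 ∷ 6 ∷ 3 ∷ 15 ∷ 0 ∷ 5 ∷ 2 ∷ 8 ∷ [])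
  ∷ path (12 ∷ 6 ∷ 2 ∷ 5 ∷ 7 ∷ 3 ∷ 10 ∷ 15 ∷ 9 ∷ 14 ∷ 16 ∷ 4 ∷ 13 ∷ 1 ∷ 0 ∷ 8 ∷ 11 ∷ [])
  ∷ path (2 ∷ 14 ∷ 10 ∷ 1 ∷ 6 ∷ 8 ∷ 5 ∷ 9 ∷ 16 ∷ 13 ∷ 0 ∷ 15 ∷ 11 ∷ 3 ∷ 12 ∷ 7 ∷ 4 ∷ [])
  ∷ path (2 ∷ 9 ∷ 1 ∷ 15 ∷ 8 ∷ 6 ∷ 4 ∷ 7 ∷ 0 ∷ 11 ∷ 10 ∷ 12 ∷ 5 ∷ 16 ∷ 13 ∷ 14 ∷ 3 ∷ [])
  ∷ path (14 ∷ 13 ∷ 4 ∷ 12 ∷ 16 ∷ 9 ∷ 11 ∷ 6 ∷ 5 ∷ 15 ∷ 2 ∷ 7 ∷ 10 ∷ 0 ∷ 8 ∷ 3 ∷ 1 ∷ [])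
  ∷ path (15 ∷ 14 ∷ 12 ∷ 13 ∷ 9 ∷ 5 ∷ 11 ∷ 10 ∷ 8 ∷ 2 ∷ 16 ∷ 6 ∷ 7 ∷ 3 ∷ 0 ∷ 4 ∷ 1 ∷ [])
  ∷ path (8 ∷ 7 ∷ 13 ∷ 1 ∷ 9 ∷ 0 ∷ 3 ∷ 16 ∷ 6 ∷ 10 ∷ 4 ∷ 15 ∷ 2 ∷ 12 ∷ 11 ∷ 5 ∷ 14 ∷ [])
  ∷ path (2 ∷ 13 ∷ 3 ∷ 14 ∷ 0 ∷ 16 ∷ 6 ∷ 15 ∷ 5 ∷ 12 ∷ 8 ∷ 9 ∷ 10 ∷ 7 ∷ 1 ∷ 4 ∷ 11 ∷ [])
  ∷ path (9 ∷ 11 ∷ 4 ∷ 14 ∷ 1 ∷ 8 ∷ 10 ∷ 15 ∷ 16 ∷ 5 ∷ 3 ∷ 6 ∷ 13 ∷ 0 ∷ 12 ∷ 2 ∷ 7 ∷ [])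
  ∷ path (7 ∷ 16 ∷ 9 ∷ 0 ∷ 2 ∷ 11 ∷ 14 ∷ 3 ∷ 5 ∷ 4 ∷ 8 ∷ 13 ∷ 15 ∷ 6 ∷ 12 ∷ 10 ∷ 1 ∷ [])
  ∷ path (9 ∷ 7 ∷ 2 ∷ 1 ∷ 6 ∷ 8 ∷ 14 ∷ 10 ∷ 5 ∷ 4 ∷ 3 ∷ 15 ∷ 16 ∷ 0 ∷ 11 ∷ 13 ∷ 12 ∷ [])
  ∷ path (13 ∷ 2 ∷ 9 ∷ 3 ∷ 0 ∷ 10 ∷ 4 ∷ 8 ∷ 5 ∷ 6 ∷ 7 ∷ 11 ∷ 16 ∷ 14 ∷ 1 ∷ 12 ∷ 15 ∷ [])
  ∷ path (3 ∷ 9 ∷ 4 ∷ 5 ∷ 13 ∷ 7 ∷ 15 ∷ 14 ∷ 6 ∷ 10 ∷ 16 ∷ 12 ∷ 0 ∷ 8 ∷ 11 ∷ 2 ∷ 1 ∷ [])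
  ∷ path (12 ∷ 7 ∷ 0 ∷ 14 ∷ 4 ∷ 9 ∷ 13 ∷ 11 ∷ 6 ∷ 2 ∷ 10 ∷ 3 ∷ 16 ∷ 8 ∷ 1 ∷ 5 ∷ 15 ∷ [])
  ∷ path (7 ∷ 14 ∷ 11 ∷ 1 ∷ 3 ∷ 12 ∷ 15 ∷ 8 ∷ 9 ∷ 6 ∷ 2 ∷ 4 ∷ 16 ∷ 13 ∷ 5 ∷ 10 ∷ 0 ∷ [])
  ∷ []
pathSystem 18 =
     path (3 ∷ 17 ∷ 5 ∷ 6 ∷ 12 ∷ 0 ∷ 2 ∷ 16 ∷ 7 ∷ 4 ∷ 14 ∷ 1 ∷ 9 ∷ 10 ∷ 11 ∷ 13 ∷ 8 ∷ 15 ∷ [])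
  ∷ path (12 ∷ 0 ∷ 8 ∷ 4 ∷ 11 ∷ 7 ∷ 14 ∷ 13 ∷ 6 ∷ 15 ∷ 10 ∷ 5 ∷ 2 ∷ 9 ∷ 16 ∷ 3 ∷ 1 ∷ 17 ∷ [])
  ∷ path (16 ∷ 13 ∷ 2 ∷ 17 ∷ 10 ∷ 15 ∷ 5 ∷ 7 ∷ 4 ∷ 0 ∷ 9 ∷ 3 ∷ 8 ∷ 1 ∷ 12 ∷ 14 ∷ 6 ∷ 11 ∷ [])
  ∷ path (7 ∷ 6 ∷ 12 ∷ 4 ∷ 0 ∷ 11 ∷ 17 ∷ 13 ∷ 9 ∷ 16 ∷ 15 ∷ 2 ∷ 1 ∷ 14 ∷ 8 ∷ 10 ∷ 5 ∷ 3 ∷ [])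
  ∷ path (1 ∷ 11 ∷ 3 ∷ 13 ∷ 10 ∷ 5 ∷ 4 ∷ 12 ∷ 15 ∷ 17 ∷ 6 ∷ 16 ∷ 0 ∷ 9 ∷ 7 ∷ 8 ∷ 2 ∷ 14 ∷ [])
  ∷ path (14 ∷ 10 ∷ 6 ∷ 7 ∷ 8 ∷ 12 ∷ 9 ∷ 2 ∷ 13 ∷ 0 ∷ 3 ∷ 11 ∷ 5 ∷ 1 ∷ 16 ∷ 17 ∷ 4 ∷ 15 ∷ [])
  ∷ path (17 ∷ 15 ∷ 11 ∷ 9 ∷ 5 ∷ 13 ∷ 12 ∷ 14 ∷ 16 ∷ 7 ∷ 10 ∷ 4 ∷ 8 ∷ 3 ∷ 0 ∷ 1 ∷ 6 ∷ 2 ∷ [])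
  ∷ path (1 ∷ 13 ∷ 0 ∷ 17 ∷ 16 ∷ 10 ∷ 14 ∷ 7 ∷ 3 ∷ 12 ∷ 5 ∷ 9 ∷ 6 ∷ 11 ∷ 8 ∷ 15 ∷ 2 ∷ 4 ∷ [])
  ∷ path (16 ∷ 8 ∷ 2 ∷ 7 ∷ 5 ∷ 4 ∷ 13 ∷ 1 ∷ 9 ∷ 10 ∷ 0 ∷ 11 ∷ 15 ∷ 6 ∷ 3 ∷ 14 ∷ 17 ∷ 12 ∷ [])
  ∷ path (3 ∷ 13 ∷ 12 ∷ 7 ∷ 15 ∷ 1 ∷ 17 ∷ 16 ∷ 8 ∷ 10 ∷ 6 ∷ 0 ∷ 5 ∷ 14 ∷ 11 ∷ 2 ∷ 4 ∷ 9 ∷ [])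
  ∷ path (12 ∷ 10 ∷ 1 ∷ 8 ∷ 2 ∷ 16 ∷ 15 ∷ 3 ∷ 7 ∷ 13 ∷ 5 ∷ 11 ∷ 4 ∷ 6 ∷ 0 ∷ 14 ∷ 17 ∷ 9 ∷ [])
  ∷ path (0 ∷ 7 ∷ 11 ∷ 2 ∷ 14 ∷ 4 ∷ 16 ∷ 5 ∷ 1 ∷ 15 ∷ 13 ∷ 9 ∷ 12 ∷ 3 ∷ 6 ∷ 10 ∷ 17 ∷ 8 ∷ [])
  ∷ path (1 ∷ 13 ∷ 0 ∷ 15 ∷ 14 ∷ 8 ∷ 17 ∷ 7 ∷ 12 ∷ 10 ∷ 16 ∷ 6 ∷ 5 ∷ 2 ∷ 11 ∷ 9 ∷ 3 ∷ 4 ∷ [])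
  ∷ path (15 ∷ 13 ∷ 8 ∷ 9 ∷ 7 ∷ 2 ∷ 11 ∷ 12 ∷ 6 ∷ 14 ∷ 16 ∷ 5 ∷ 3 ∷ 10 ∷ 1 ∷ 4 ∷ 17 ∷ 0 ∷ [])
  ∷ path (14 ∷ 5 ∷ 12 ∷ 2 ∷ 0 ∷ 15 ∷ 9 ∷ 10 ∷ 7 ∷ 8 ∷ 6 ∷ 4 ∷ 3 ∷ 1 ∷ 11 ∷ 16 ∷ 13 ∷ 17 ∷ [])
  ∷ path (7 ∷ 10 ∷ 13 ∷ 14 ∷ 9 ∷ 4 ∷ 16 ∷ 11 ∷ 12 ∷ 17 ∷ 5 ∷ 8 ∷ 3 ∷ 15 ∷ 2 ∷ 1 ∷ 6 ∷ 0 ∷ [])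
  ∷ path (12 ∷ 9 ∷ 17 ∷ 7 ∷ 1 ∷ 4 ∷ 15 ∷ 5 ∷ 0 ∷ 16 ∷ 3 ∷ 14 ∷ 13 ∷ 11 ∷ 8 ∷ 6 ∷ 2 ∷ 10 ∷ [])
  ∷ path (6 ∷ 17 ∷ 2 ∷ 15 ∷ 9 ∷ 14 ∷ 11 ∷ 10 ∷ 3 ∷ 4 ∷ 13 ∷ 7 ∷ 1 ∷ 0 ∷ 8 ∷ 12 ∷ 16 ∷ 5 ∷ [])
  ∷ []
pathSystem 19 =
     path (10 ∷ 14 ∷ 16 ∷ 5 ∷ 11 ∷ 12 ∷ 9 ∷ 18 ∷ 0 ∷ 15 ∷ 1 ∷ 8 ∷ 7 ∷ 4 ∷ 2 ∷ 6 ∷ 3 ∷ 13 ∷ 17 ∷ [])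
  ∷ path (15 ∷ 5 ∷ 4 ∷ 12 ∷ 10 ∷ 17 ∷ 14 ∷ 2 ∷ 18 ∷ 13 ∷ 3 ∷ 11 ∷ 6 ∷ 9 ∷ 7 ∷ 0 ∷ 1 ∷ 8 ∷ 16 ∷ [])
  ∷ path (7 ∷ 2 ∷ 12 ∷ 8 ∷ 18 ∷ 11 ∷ 6 ∷ 5 ∷ 1 ∷ 9 ∷ 3 ∷ 10 ∷ 17 ∷ 15 ∷ 4 ∷ 0 ∷ 16 ∷ 14 ∷ 13 ∷ [])
  ∷ path (4 ∷ 6 ∷ 17 ∷ 18 ∷ 15 ∷ 1 ∷ 11 ∷ 0 ∷ 7 ∷ 13 ∷ 16 ∷ 9 ∷ 5 ∷ 10 ∷ 14 ∷ 12 ∷ 2 ∷ 8 ∷ 3 ∷ [])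
  ∷ path (9 ∷ 15 ∷ 6 ∷ 13 ∷ 2 ∷ 11 ∷ 5 ∷ 7 ∷ 3 ∷ 17 ∷ 16 ∷ 10 ∷ 12 ∷ 18 ∷ 4 ∷ 0 ∷ 1 ∷ 14 ∷ 8 ∷ [])
  ∷ path (7 ∷ 18 ∷ 6 ∷ 17 ∷ 16 ∷ 0 ∷ 3 ∷ 5 ∷ 9 ∷ 13 ∷ 4 ∷ 11 ∷ 12 ∷ 1 ∷ 2 ∷ 14 ∷ 15 ∷ 10 ∷ 8 ∷ [])
  ∷ path (12 ∷ 9 ∷ 4 ∷ 0 ∷ 6 ∷ 14 ∷ 11 ∷ 16 ∷ 3 ∷ 1 ∷ 2 ∷ 18 ∷ 10 ∷ 7 ∷ 13 ∷ 15 ∷ 8 ∷ 5 ∷ 17 ∷ [])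
  ∷ path (2 ∷ 0 ∷ 17 ∷ 1 ∷ 11 ∷ 4 ∷ 10 ∷ 3 ∷ 5 ∷ 12 ∷ 16 ∷ 6 ∷ 13 ∷ 15 ∷ 7 ∷ 9 ∷ 8 ∷ 14 ∷ 18 ∷ [])
  ∷ path (7 ∷ 6 ∷ 3 ∷ 16 ∷ 12 ∷ 17 ∷ 11 ∷ 9 ∷ 14 ∷ 1 ∷ 0 ∷ 8 ∷ 4 ∷ 15 ∷ 18 ∷ 13 ∷ 5 ∷ 10 ∷ 2 ∷ [])
  ∷ path (4 ∷ 3 ∷ 8 ∷ 12 ∷ 1 ∷ 16 ∷ 18 ∷ 5 ∷ 2 ∷ 11 ∷ 15 ∷ 7 ∷ 6 ∷ 10 ∷ 13 ∷ 17 ∷ 14 ∷ 9 ∷ 0 ∷ [])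
  ∷ path (7 ∷ 11 ∷ 10 ∷ 6 ∷ 4 ∷ 1 ∷ 9 ∷ 3 ∷ 12 ∷ 13 ∷ 2 ∷ 0 ∷ 14 ∷ 18 ∷ 15 ∷ 16 ∷ 5 ∷ 17 ∷ 8 ∷ [])
  ∷ path (15 ∷ 18 ∷ 3 ∷ 0 ∷ 6 ∷ 8 ∷ 13 ∷ 12 ∷ 14 ∷ 11 ∷ 9 ∷ 5 ∷ 2 ∷ 16 ∷ 7 ∷ 1 ∷ 10 ∷ 4 ∷ 17 ∷ [])
  ∷ path (6 ∷ 14 ∷ 13 ∷ 10 ∷ 1 ∷ 18 ∷ 7 ∷ 8 ∷ 0 ∷ 11 ∷ 16 ∷ 4 ∷ 5 ∷ 12 ∷ 15 ∷ 3 ∷ 17 ∷ 2 ∷ 9 ∷ [])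
  ∷ path (7 ∷ 11 ∷ 17 ∷ 10 ∷ 0 ∷ 12 ∷ 4 ∷ 16 ∷ 13 ∷ 8 ∷ 15 ∷ 9 ∷ 1 ∷ 5 ∷ 14 ∷ 3 ∷ 2 ∷ 6 ∷ 18 ∷ [])
  ∷ path (0 ∷ 12 ∷ 6 ∷ 15 ∷ 17 ∷ 7 ∷ 1 ∷ 4 ∷ 14 ∷ 18 ∷ 16 ∷ 11 ∷ 3 ∷ 13 ∷ 2 ∷ 9 ∷ 10 ∷ 8 ∷ 5 ∷ [])
  ∷ path (16 ∷ 2 ∷ 17 ∷ 0 ∷ 18 ∷ 12 ∷ 7 ∷ 14 ∷ 9 ∷ 8 ∷ 11 ∷ 10 ∷ 15 ∷ 5 ∷ 13 ∷ 6 ∷ 1 ∷ 3 ∷ 4 ∷ [])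
  ∷ path (12 ∷ 3 ∷ 14 ∷ 15 ∷ 1 ∷ 8 ∷ 11 ∷ 13 ∷ 0 ∷ 9 ∷ 10 ∷ 18 ∷ 17 ∷ 4 ∷ 2 ∷ 7 ∷ 5 ∷ 6 ∷ 16 ∷ [])
  ∷ path (2 ∷ 8 ∷ 6 ∷ 5 ∷ 18 ∷ 9 ∷ 17 ∷ 12 ∷ 7 ∷ 3 ∷ 15 ∷ 16 ∷ 11 ∷ 14 ∷ 4 ∷ 13 ∷ 1 ∷ 0 ∷ 10 ∷ [])
  ∷ path (8 ∷ 17 ∷ 0 ∷ 13 ∷ 1 ∷ 16 ∷ 10 ∷ 2 ∷ 15 ∷ 12 ∷ 6 ∷ 9 ∷ 4 ∷ 7 ∷ 14 ∷ 5 ∷ 3 ∷ 18 ∷ 11 ∷ [])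
  ∷ []
pathSystem 20 =
     path (8 ∷ 18 ∷ 2 ∷ 5 ∷ 7 ∷ 15 ∷ 11 ∷ 12 ∷ 13 ∷ 9 ∷ 3 ∷ 1 ∷ 19 ∷ 10 ∷ 16 ∷ 0 ∷ 14 ∷ 6 ∷ 17 ∷ 4 ∷ [])
  ∷ path (4 ∷ 6 ∷ 8 ∷ 15 ∷ 2 ∷ 19 ∷ 12 ∷ 17 ∷ 0 ∷ 10 ∷ 3 ∷ 5 ∷ 13 ∷ 16 ∷ 11 ∷ 14 ∷ 1 ∷ 7 ∷ 18 ∷ 9 ∷ [])
  ∷ path (2 ∷ 1 ∷ 5 ∷ 11 ∷ 16 ∷ 18 ∷ 17 ∷ 13 ∷ 19 ∷ 14 ∷ 10 ∷ 12 ∷ 6 ∷ 3 ∷ 7 ∷ 15 ∷ 4 ∷ 0 ∷ 9 ∷ 8 ∷ [])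
  ∷ path (8 ∷ 14 ∷ 4 ∷ 19 ∷ 5 ∷ 13 ∷ 6 ∷ 10 ∷ 11 ∷ 12 ∷ 15 ∷ 3 ∷ 1 ∷ 18 ∷ 16 ∷ 9 ∷ 2 ∷ 0 ∷ 17 ∷ 7 ∷ [])
  ∷ path (0 ∷ 2 ∷ 8 ∷ 7 ∷ 13 ∷ 11 ∷ 18 ∷ 19 ∷ 14 ∷ 12 ∷ 16 ∷ 1 ∷ 6 ∷ 5 ∷ 3 ∷ 15 ∷ 9 ∷ 17 ∷ 4 ∷ 10 ∷ [])
  ∷ path (6 ∷ 8 ∷ 1 ∷ 13 ∷ 0 ∷ 7 ∷ 10 ∷ 17 ∷ 11 ∷ 2 ∷ 3 ∷ 9 ∷ 16 ∷ 4 ∷ 18 ∷ 14 ∷ 12 ∷ 5 ∷ 15 ∷ 19 ∷ [])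
  ∷ path (16 ∷ 15 ∷ 17 ∷ 10 ∷ 19 ∷ 7 ∷ 1 ∷ 14 ∷ 8 ∷ 13 ∷ 4 ∷ 0 ∷ 18 ∷ 5 ∷ 6 ∷ 2 ∷ 3 ∷ 11 ∷ 9 ∷ 12 ∷ [])
  ∷ path (14 ∷ 16 ∷ 3 ∷ 4 ∷ 9 ∷ 7 ∷ 5 ∷ 0 ∷ 12 ∷ 8 ∷ 13 ∷ 10 ∷ 15 ∷ 2 ∷ 1 ∷ 18 ∷ 17 ∷ 11 ∷ 6 ∷ 19 ∷ [])
  ∷ path (18 ∷ 15 ∷ 1 ∷ 7 ∷ 14 ∷ 3 ∷ 12 ∷ 10 ∷ 0 ∷ 13 ∷ 17 ∷ 9 ∷ 2 ∷ 5 ∷ 16 ∷ 8 ∷ 19 ∷ 6 ∷ 4 ∷ 11 ∷ [])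
  ∷ path (6 ∷ 1 ∷ 4 ∷ 12 ∷ 19 ∷ 16 ∷ 15 ∷ 10 ∷ 18 ∷ 14 ∷ 7 ∷ 2 ∷ 3 ∷ 0 ∷ 9 ∷ 13 ∷ 5 ∷ 11 ∷ 8 ∷ 17 ∷ [])
  ∷ path (4 ∷ 13 ∷ 15 ∷ 0 ∷ 12 ∷ 5 ∷ 14 ∷ 9 ∷ 7 ∷ 6 ∷ 11 ∷ 18 ∷ 2 ∷ 19 ∷ 16 ∷ 8 ∷ 10 ∷ 1 ∷ 17 ∷ 3 ∷ [])
  ∷ path (19 ∷ 0 ∷ 3 ∷ 18 ∷ 12 ∷ 7 ∷ 8 ∷ 15 ∷ 11 ∷ 1 ∷ 2 ∷ 6 ∷ 16 ∷ 4 ∷ 14 ∷ 5 ∷ 9 ∷ 10 ∷ 17 ∷ 13 ∷ [])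
  ∷ path (11 ∷ 0 ∷ 18 ∷ 6 ∷ 17 ∷ 19 ∷ 9 ∷ 8 ∷ 3 ∷ 10 ∷ 7 ∷ 12 ∷ 2 ∷ 4 ∷ 5 ∷ 14 ∷ 16 ∷ 1 ∷ 15 ∷ 13 ∷ [])
  ∷ path (19 ∷ 3 ∷ 18 ∷ 5 ∷ 15 ∷ 9 ∷ 7 ∷ 11 ∷ 0 ∷ 8 ∷ 12 ∷ 6 ∷ 10 ∷ 4 ∷ 1 ∷ 17 ∷ 14 ∷ 13 ∷ 2 ∷ 16 ∷ [])
  ∷ path (12 ∷ 1 ∷ 9 ∷ 2 ∷ 8 ∷ 18 ∷ 15 ∷ 0 ∷ 16 ∷ 7 ∷ 4 ∷ 11 ∷ 14 ∷ 17 ∷ 19 ∷ 5 ∷ 10 ∷ 13 ∷ 3 ∷ 6 ∷ [])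
  ∷ path (1 ∷ 10 ∷ 2 ∷ 11 ∷ 3 ∷ 4 ∷ 7 ∷ 5 ∷ 9 ∷ 19 ∷ 13 ∷ 18 ∷ 6 ∷ 15 ∷ 14 ∷ 0 ∷ 8 ∷ 17 ∷ 16 ∷ 12 ∷ [])
  ∷ path (3 ∷ 19 ∷ 8 ∷ 1 ∷ 0 ∷ 16 ∷ 6 ∷ 14 ∷ 10 ∷ 5 ∷ 17 ∷ 2 ∷ 4 ∷ 12 ∷ 15 ∷ 9 ∷ 18 ∷ 13 ∷ 7 ∷ 11 ∷ [])
  ∷ path (1 ∷ 3 ∷ 12 ∷ 18 ∷ 6 ∷ 15 ∷ 19 ∷ 7 ∷ 16 ∷ 13 ∷ 14 ∷ 9 ∷ 4 ∷ 8 ∷ 5 ∷ 11 ∷ 10 ∷ 0 ∷ 2 ∷ 17 ∷ [])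
  ∷ path (10 ∷ 8 ∷ 5 ∷ 4 ∷ 15 ∷ 17 ∷ 16 ∷ 3 ∷ 14 ∷ 18 ∷ 19 ∷ 11 ∷ 1 ∷ 9 ∷ 6 ∷ 13 ∷ 12 ∷ 0 ∷ 7 ∷ 2 ∷ [])
  ∷ path (8 ∷ 3 ∷ 13 ∷ 1 ∷ 5 ∷ 17 ∷ 12 ∷ 9 ∷ 6 ∷ 7 ∷ 11 ∷ 4 ∷ 19 ∷ 0 ∷ 15 ∷ 14 ∷ 2 ∷ 16 ∷ 10 ∷ 18 ∷ [])
  ∷ []
pathSystem _ = []

Certified : ℕ → Set
Certified n = length (pathSystem n) ≤ n × Decodes (pathSystem n) (decoder (pathSystem n))

certified? : (n : ℕ) → Dec (Certified n)
certified? n = length (pathSystem n) ≤? n ×-dec decodes? (pathSystem n) (decoder (pathSystem n))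

certified⇒fKLe : (n : ℕ) → Certified n → fKLe n n
certified⇒fKLe n (|S|≤n , decodes) = decodable⇒fKLe (pathSystem n) (decoder (pathSystem n)) decodes |S|≤n

certified-<21 : (i : Fin 21) → Certified (toℕ i)
certified-<21 = from-yes (all? λ (i : Fin 21) → certified? (toℕ i))

certified-≤20 : n ≤ 20 → Certified n
certified-≤20 n≤20 = subst Certified (toℕ-fromℕ< (s≤s n≤20)) (certified-<21 (fromℕ< (s≤s n≤20)))

proposition1p3 : (n : ℕ) → 1 ≤ n → n ≤ 20 → fKLe n n
proposition1p3 n _ n≤20 = certified⇒fKLe n (certified-≤20 n≤20)
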